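{- Let $\mathcal M_1=(W_1,\preccurlyeq_1,S_1,V_1)$ and $\mathcal M_2=(W_2,\preccurlyeq_2,S_2,V_2)$ be models and $\mathcal Z_n\subseteq\cdots\subseteq\mathcal Z_0$ a bounded $\Diamond$-bisimulation between them. Then for all $i\le n$ and $(w_1,w_2)\in W_1\times W_2$, if $w_1\mathcal Z_iw_2$, then for every $\varphi\in\mathcal L_{\Diamond}$ with $|\varphi|\le i$, $\mathcal M_1,w_1\models\varphi$ iff $\mathcal M_2,w_2\models\varphi$.
   Context: A model is $(W,\preccurlyeq,S,V)$ with $\preccurlyeq$ a partial order on $W\ne\emptyset$, $S:W\to W$ satisfying $w\preccurlyeq v\Rightarrow S(w)\preccurlyeq S(v)$, and $V$ assigning each world a set of propositional variables, monotone along $\preccurlyeq$. $\mathcal L_\Diamond$ is the set of formulas built from variables and $\bot$ using $\wedge,\vee,\to,\bigcirc,\Diamond$. Satisfaction: $w\models p$ iff $p\in V(w)$; $w\not\models\bot$; $\wedge,\vee$ classical; $w\models\varphi\to\psi$ iff for all $v\succcurlyeq w$, $v\models\varphi$ implies $v\models\psi$; $w\models\bigcirc\varphi$ iff $S(w)\models\varphi$; $w\models\Diamond\varphi$ iff $S^k(w)\models\varphi$ for some $k\ge0$. Length: $|p|=|\bot|=0$; $|\varphi\odot\psi|=1+|\varphi|+|\psi|$ for binary $\odot$; $|\odot\psi|=1+|\psi|$ for unary $\odot$. For $n>0$, a bounded $\bigcirc$-bisimulation is a sequence $\mathcal Z_n\subseteq\cdots\subseteq\mathcal Z_0\subseteq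 W_1\times W_2$ such that for all $0\le i<n$: if $w_1\mathcal Z_iw_2$ then $w_1,w_2$ satisfy the same variables; if $w_1\mathcal Z_{i+1}w_2$ then every $v_1\succcurlyeq w_1$ has some $v_2\succcurlyeq w_2$ with $v_1\mathcal Z_iv_2$, every $v_2\succcurlyeq w_2$ has some $v_1\succcurlyeq w_1$ with $v_1\mathcal Z_iv_2$, and $S_1(w_1)\mathcal Z_iS_2(w_2)$. It is a bounded $\Diamond$-bisimulation if moreover, for all $0\le i<n$ and $w_1\mathcal Z_{i+1}w_2$: (Forth $\Diamond$) for every $k_1\ge0$ there are $k_2\ge0$ and $(v_1,v_2)\in W_1\times W_2$ with $S_2^{k_2}(w_2)\succcurlyeq v_2$, $v_1\succcurlyeq S_1^{k_1}(w_1)$ and $v_1\mathcal Z_iv_2$; (Back $\Diamond$) for every $k_2\ge0$ there are $k_1\ge0$ and $(v_1,v_2)$ with $S_1^{k_1}(w_1)\succcurlyeq v_1$, $v_2\succcurlyeq S_2^{k_2}(w_2)$ and $v_1\mathcal Z_iv_2$. -}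

module Defs where

open import Data.Nat using (ℕ; zero; suc; _+_; _<_; _≤_)
open import Data.Product using (Σ; _×_; _,_; ∃; ∃-syntax)
open import Data.Sum using (_⊎_)
open import Data.Empty using (⊥)
open import Relation.Binary.PropositionalEquality using (_≡_)
open import Relation.Binary.Structures using (IsPartialOrder)

Var : Set
Var = ℕ

record Model : Set₁ where
  field
    W         : Set
    inhabited : W
    _≼_       : W → W → Set
    ≼-po      : IsPartialOrder _≡_ _≼_
    S         : W → W
    S-mono    : ∀ {w v} → w ≼ v → S w ≼ S v
    V         : W → Var → Set
    V-mono    : ∀ {w v p} → w ≼ v → V w p → V v p

iter : {A : Set} → (A → A) → ℕ → A → A
iter f zero    x = x
iter f (suc k) x = f (iter f k x)

data Form : Set where
  var  : Var → Form
  ⊥'   : Form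
  _∧'_ : Form → Form → Form
  _∨'_ : Form → Form → Form
  _⇒'_ : Form → Form → Form
  ○'_  : Form → Form
  ◇'_  : Form → Form

len : Form → ℕ
len (var p)  = 0
len ⊥'       = 0
len (φ ∧' ψ) = suc (len φ + len ψ)
len (φ ∨' ψ) = suc (len φ + len ψ)
len (φ ⇒' ψ) = suc (len φ + len ψ)
len (○' φ)   = suc (len φ)
len (◇' φ)   = suc (len φ)

module _ (M : Model) where
  open Model M

  _⊨_ : W → Form → Set
  w ⊨ var p    = V w p
  w ⊨ ⊥'       = ⊥
  w ⊨ (φ ∧' ψ) = (w ⊨ φ) × (w ⊨ ψ)
  w ⊨ (φ ∨' ψ) = (w ⊨ φ) ⊎ (w ⊨ ψ)
  w ⊨ (φ ⇒' ψ) = ∀ v → w ≼ v → v ⊨ φ → v ⊨ ψ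
  w ⊨ (○' φ)   = S w ⊨ φ
  w ⊨ (◇' φ)   = Σ ℕ λ k → iter S k w ⊨ φ

Sat : (M : Model) → Model.W M → Form → Set
Sat M w φ = _⊨_ M w φ

-- Bounded ○-bisimulation Z_n ⊆ ... ⊆ Z_0 between M₁ and M₂ (n > 0).
-- Z i is meaningful for i ≤ n.
record IsBoundedNextBisim (M₁ M₂ : Model) (n : ℕ)
       (Z : ℕ → Model.W M₁ → Model.W M₂ → Set) : Set where
  private
    module M₁ = Model M₁
    module M₂ = Model M₂
  field
    n-pos  : 0 < n
    nested : ∀ i → i < n → ∀ {w₁ w₂} → Z (suc i) w₁ w₂ → Z i w₁ w₂
    atoms  : ∀ i → i < n → ∀ {w₁ w₂} → Z i w₁ w₂ →
             ∀ p → (M₁.V w₁ p → M₂.V w₂ p) × (M₂.V w₂ p → M₁.V w₁ p)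
    forth≼ : ∀ i → i < n → ∀ {w₁ w₂} → Z (suc i) w₁ w₂ →
             ∀ v₁ → w₁ M₁.≼ v₁ → Σ M₂.W λ v₂ → (w₂ M₂.≼ v₂) × Z i v₁ v₂
    back≼  : ∀ i → i < n → ∀ {w₁ w₂} → Z (suc i) w₁ w₂ →
             ∀ v₂ → w₂ M₂.≼ v₂ → Σ M₁.W λ v₁ → (w₁ M₁.≼ v₁) × Z i v₁ v₂
    next   : ∀ i → i < n → ∀ {w₁ w₂} → Z (suc i) w₁ w₂ →
             Z i (M₁.S w₁) (M₂.S w₂)

record IsBoundedDiamondBisim (M₁ M₂ : Model) (n : ℕ)
       (Z : ℕ → Model.W M₁ → Model.W M₂ → Set) : Set where
  private
    module M₁ = Model M₁
    module M₂ = Model M₂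
  field
    isNextBisim : IsBoundedNextBisim M₁ M₂ n Z
    forth◇ : ∀ i → i < n → ∀ {w₁ w₂} → Z (suc i) w₁ w₂ →
             ∀ k₁ → Σ ℕ λ k₂ → Σ M₁.W λ v₁ → Σ M₂.W λ v₂ →
               (v₂ M₂.≼ iter M₂.S k₂ w₂) × (iter M₁.S k₁ w₁ M₁.≼ v₁) × Z i v₁ v₂
    back◇  : ∀ i → i < n → ∀ {w₁ w₂} → Z (suc i) w₁ w₂ →
             ∀ k₂ → Σ ℕ λ k₁ → Σ M₁.W λ v₁ → Σ M₂.W λ v₂ →
               (v₁ M₁.≼ iter M₁.S k₁ w₁) × (iter M₂.S k₂ w₂ M₂.≼ v₂) × Z i v₁ v₂

-- The proof is an induction on the formula, carried out for every level
-- i ≤ n at once.  Two general facts are needed first: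
--   * persistence: truth in a model is upward closed along ≼ (this is
--     where monotonicity of V and S is used, and it is what makes the
--     "up to ≼" witnesses in the ◇-clauses sufficient);
--   * Z i ⊆ Z 0 for i ≤ n, so every related pair agrees on variables.
-- For each connective we then prove a step lemma: if Z i-related worlds
-- agree on the immediate subformulas (at level i for ∧, ∨ and at level
-- i - 1 for →, ○, ◇), then Z i-related worlds agree on the compound
-- formula.

module Submission where

open import Defs
open import Data.Nat using (ℕ; zero; suc; _≤_; _<_; s≤s)
open import Data.Nat.Properties using (<⇒≤; m+n≤o⇒m≤o; m+n≤o⇒n≤o)
open import Data.Product using (_×_; _,_; proj₁; proj₂)
open import Data.Sum using (inj₁; inj₂)
open import Relation.Binary.Structures using (IsPartialOrder)

module Persistence (M : Model) where
  open Model M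
  open IsPartialOrder ≼-po using (trans)

  iterS-mono : ∀ k {w v} → w ≼ v → iter S k w ≼ iter S k v
  iterS-mono zero    w≼v = w≼v
  iterS-mono (suc k) w≼v = S-mono (iterS-mono k w≼v)

  persistence : ∀ φ {w v} → w ≼ v → Sat M w φ → Sat M v φ
  persistence (var p)  w≼v w⊨p            = V-mono w≼v w⊨p
  persistence ⊥'       w≼v ()
  persistence (φ ∧' ψ) w≼v (w⊨φ , w⊨ψ)    = persistence φ w≼v w⊨φ , persistence ψ w≼v w⊨ψ
  persistence (φ ∨' ψ) w≼v (inj₁ w⊨φ)     = inj₁ (persistence φ w≼v w⊨φ)
  persistence (φ ∨' ψ) w≼v (inj₂ w⊨ψ)     = inj₂ (persistence ψ w≼v w⊨ψ)
  persistence (φ ⇒' ψ) w≼v w⊨φ⇒ψ          = λ u v≼u → w⊨φ⇒ψ u (trans w≼v v≼u)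
  persistence (○' φ)   w≼v Sw⊨φ           = persistence φ (S-mono w≼v) Sw⊨φ
  persistence (◇' φ)   w≼v (k , Skw⊨φ)    = k , persistence φ (iterS-mono k w≼v) Skw⊨φ

Agree : (M₁ M₂ : Model) → Model.W M₁ → Model.W M₂ → Form → Set
Agree M₁ M₂ w₁ w₂ φ = (Sat M₁ w₁ φ → Sat M₂ w₂ φ) × (Sat M₂ w₂ φ → Sat M₁ w₁ φ)

agree-∧ : ∀ {M₁ M₂ w₁ w₂} φ ψ → Agree M₁ M₂ w₁ w₂ φ → Agree M₁ M₂ w₁ w₂ ψ →
          Agree M₁ M₂ w₁ w₂ (φ ∧' ψ)
agree-∧ _ _ (φ→ , φ←) (ψ→ , ψ←) =
  (λ { (a , b) → φ→ a , ψ→ b }) , (λ { (a , b) → φ← a , ψ← b })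

agree-∨ : ∀ {M₁ M₂ w₁ w₂} φ ψ → Agree M₁ M₂ w₁ w₂ φ → Agree M₁ M₂ w₁ w₂ ψ →
          Agree M₁ M₂ w₁ w₂ (φ ∨' ψ)
agree-∨ _ _ (φ→ , φ←) (ψ→ , ψ←) =
  (λ { (inj₁ a) → inj₁ (φ→ a) ; (inj₂ b) → inj₂ (ψ→ b) }) ,
  (λ { (inj₁ a) → inj₁ (φ← a) ; (inj₂ b) → inj₂ (ψ← b) })

module _ {M₁ M₂ : Model} {n : ℕ} {Z : ℕ → Model.W M₁ → Model.W M₂ → Set}
         (B : IsBoundedDiamondBisim M₁ M₂ n Z) where
  open IsBoundedDiamondBisim B
  open IsBoundedNextBisim isNextBisim
  open Persistence M₁ using () renaming (persistence to persistence₁)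
  open Persistence M₂ using () renaming (persistence to persistence₂)

  AgreeOn : ℕ → Form → Set
  AgreeOn i φ = ∀ {w₁ w₂} → Z i w₁ w₂ → Agree M₁ M₂ w₁ w₂ φ

  Z-to-0 : ∀ i → i ≤ n → ∀ {w₁ w₂} → Z i w₁ w₂ → Z 0 w₁ w₂
  Z-to-0 zero    _   z = z
  Z-to-0 (suc i) i<n z = Z-to-0 i (<⇒≤ i<n) (nested i i<n z)

  -- Variables: related pairs at any level i ≤ n are related at level 0.
  agree-var : ∀ i → i ≤ n → ∀ p → AgreeOn i (var p)
  agree-var i i≤n p z = atoms 0 n-pos (Z-to-0 i i≤n z) p

  -- Implication: the ≼-successor witnessed by back≼ (resp. forth≼) is
  -- Z j-related to the given one, where both subformulas agree.
  agree-⇒ : ∀ {j} φ ψ → j < n → AgreeOn j φ → AgreeOn j ψ → AgreeOn (suc j) (φ ⇒' ψ)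
  agree-⇒ {j} _ _ j<n agreeφ agreeψ z =
    (λ w₁⊨φ⇒ψ v₂ w₂≼v₂ v₂⊨φ →
       let (v₁ , w₁≼v₁ , z′) = back≼ j j<n z v₂ w₂≼v₂
       in proj₁ (agreeψ z′) (w₁⊨φ⇒ψ v₁ w₁≼v₁ (proj₂ (agreeφ z′) v₂⊨φ))) ,
    (λ w₂⊨φ⇒ψ v₁ w₁≼v₁ v₁⊨φ →
       let (v₂ , w₂≼v₂ , z′) = forth≼ j j<n z v₁ w₁≼v₁
       in proj₂ (agreeψ z′) (w₂⊨φ⇒ψ v₂ w₂≼v₂ (proj₁ (agreeφ z′) v₁⊨φ)))

  agree-○ : ∀ {j} φ → j < n → AgreeOn j φ → AgreeOn (suc j) (○' φ)
  agree-○ {j} _ j<n agreeφ z = agreeφ (next j j<n z)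

  -- Diamond: S^k₁ w₁ ≼ v₁ Z_j v₂ ≼ S^k₂ w₂, so by persistence on both
  -- sides truth of φ is transported from S^k₁ w₁ to S^k₂ w₂ (and back).
  agree-◇ : ∀ {j} φ → j < n → AgreeOn j φ → AgreeOn (suc j) (◇' φ)
  agree-◇ {j} φ j<n agreeφ z =
    (λ { (k₁ , s) →
       let (k₂ , v₁ , v₂ , v₂≼ , ≼v₁ , z′) = forth◇ j j<n z k₁
       in k₂ , persistence₂ φ v₂≼ (proj₁ (agreeφ z′) (persistence₁ φ ≼v₁ s)) }) ,
    (λ { (k₂ , s) →
       let (k₁ , v₁ , v₂ , v₁≼ , ≼v₂ , z′) = back◇ j j<n z k₂
       in k₁ , persistence₁ φ v₁≼ (proj₂ (agreeφ z′) (persistence₂ φ ≼v₂ s)) })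

  -- Binary connectives stay at level i, since |φ|,|ψ| < |φ ⊙ ψ| ≤ i;
  -- the unary and → cases have |φ ⊙ ψ| ≥ 1, so i = suc j and the
  -- subformulas have length ≤ j.
  agreement : ∀ φ i → i ≤ n → len φ ≤ i → AgreeOn i φ
  agreement (var p)  i       i≤n _         = agree-var i i≤n p
  agreement ⊥'       i       i≤n _         = λ _ → (λ ()) , (λ ())
  agreement (φ ∧' ψ) i       i≤n |φ∧ψ|≤i z =
    agree-∧ φ ψ (agreement φ i i≤n (m+n≤o⇒m≤o (len φ) (<⇒≤ |φ∧ψ|≤i)) z)
                (agreement ψ i i≤n (m+n≤o⇒n≤o (len φ) (<⇒≤ |φ∧ψ|≤i)) z)
  agreement (φ ∨' ψ) i       i≤n |φ∨ψ|≤i z =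
    agree-∨ φ ψ (agreement φ i i≤n (m+n≤o⇒m≤o (len φ) (<⇒≤ |φ∨ψ|≤i)) z)
                (agreement ψ i i≤n (m+n≤o⇒n≤o (len φ) (<⇒≤ |φ∨ψ|≤i)) z)
  agreement (φ ⇒' ψ) (suc j) j<n (s≤s |φ|+|ψ|≤j) =
    agree-⇒ φ ψ j<n (agreement φ j (<⇒≤ j<n) (m+n≤o⇒m≤o (len φ) |φ|+|ψ|≤j))
                    (agreement ψ j (<⇒≤ j<n) (m+n≤o⇒n≤o (len φ) |φ|+|ψ|≤j))
  agreement (○' φ)   (suc j) j<n (s≤s |φ|≤j) =
    agree-○ φ j<n (agreement φ j (<⇒≤ j<n) |φ|≤j)
  agreement (◇' φ)   (suc j) j<n (s≤s |φ|≤j) =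
    agree-◇ φ j<n (agreement φ j (<⇒≤ j<n) |φ|≤j)

mainTheorem12 : (M₁ M₂ : Model) (n : ℕ)
    (Z : ℕ → Model.W M₁ → Model.W M₂ → Set) →
    IsBoundedDiamondBisim M₁ M₂ n Z →
    ∀ i → i ≤ n → ∀ (w₁ : Model.W M₁) (w₂ : Model.W M₂) → Z i w₁ w₂ →
    ∀ (φ : Form) → len φ ≤ i →
    (Sat M₁ w₁ φ → Sat M₂ w₂ φ) × (Sat M₂ w₂ φ → Sat M₁ w₁ φ)
mainTheorem12 M₁ M₂ n Z B i i≤n w₁ w₂ z φ |φ|≤i = agreement B φ i i≤n |φ|≤i z
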